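{- Let $k, b, d, N$ be positive integers such that every positive integer $n > N$ can be written as a sum of at most $b$ positive $k$-th powers. Suppose there exists a positive integer $n^*$ that is $(j,k)$-representable for every $j$ with $d \le j < b+d$. Then every positive integer greater than $N + n^*$ is $(b+d,k)$-representable.
   Context: For positive integers $j,k$, a positive integer $n$ is called $(j,k)$-representable if $n = x_1^k + \cdots + x_j^k$ with all $x_i$ positive integers. -}

module Defs where

open import Data.Nat using (ℕ; zero; suc; _+_; _^_; _<_)
open import Data.Fin using (Fin)
import Data.Fin as Fin
open import Data.Product using (Σ; _×_)
open import Relation.Binary.PropositionalEquality using (_≡_)

sumFin : ∀ {j} → (Fin j → ℕ) → ℕ
sumFin {zero}  x = 0
sumFin {suc j} x = x Fin.zero + sumFin (λ i → x (Fin.suc i))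

Representable : ℕ → ℕ → ℕ → Set
Representable j k n =
  Σ (Fin j → ℕ) λ x → ((i : Fin j) → 0 < x i) × (sumFin (λ i → x i ^ k) ≡ n)

-- Remove n* from n: the rest exceeds N, so it is a sum of j positive k-th powers with
-- 1 ≤ j ≤ b. The complementary count b + d − j lies in the window [d, b + d), so n* is a
-- sum of exactly that many positive k-th powers, and concatenating the two representations
-- writes n with exactly b + d terms.
module Submission where

open import Defs
open import Data.Nat using (ℕ; zero; suc; _+_; _<_; _≤_; _∸_; _^_; z<s)
open import Data.Nat.Properties
open import Data.Fin using (Fin; splitAt)
import Data.Fin as Fin
open import Data.Vec.Functional using (Vector; _++_; map)
open import Data.Product using (Σ; _×_; _,_; proj₁; proj₂)
open import Data.Sum using ([_,_])
open import Data.Sum.Properties using ([,]-map; [,]-∘)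
open import Relation.Binary.PropositionalEquality
  using (_≡_; _≗_; refl; sym; trans; cong; cong₂; subst; module ≡-Reasoning)
open import Relation.Nullary using (contradiction)

sumFin-cong : ∀ {j} {f g : Fin j → ℕ} → f ≗ g → sumFin f ≡ sumFin g
sumFin-cong {zero}  f≗g = refl
sumFin-cong {suc j} f≗g = cong₂ _+_ (f≗g Fin.zero) (sumFin-cong (λ i → f≗g (Fin.suc i)))

sumFin-++ : ∀ {a c} (xs : Vector ℕ a) (ys : Vector ℕ c) →
            sumFin (xs ++ ys) ≡ sumFin xs + sumFin ys
sumFin-++ {zero}  xs ys = refl
sumFin-++ {suc a} xs ys = begin
  xs Fin.zero + sumFin (λ i → (xs ++ ys) (Fin.suc i))
    -- (xs ++ ys) ∘ suc unfolds to [ xs , ys ] ∘ map₁ suc ∘ splitAt a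
    ≡⟨ cong (xs Fin.zero +_) (sumFin-cong (λ i → [,]-map (splitAt a i))) ⟩
  xs Fin.zero + sumFin (tail ++ ys)
    ≡⟨ cong (xs Fin.zero +_) (sumFin-++ tail ys) ⟩
  xs Fin.zero + (sumFin tail + sumFin ys)
    ≡⟨ +-assoc (xs Fin.zero) _ _ ⟨
  sumFin xs + sumFin ys ∎
  where
  open ≡-Reasoning
  tail : Vector ℕ a
  tail i = xs (Fin.suc i)

Representable-++ : ∀ {a c k m n} → Representable a k m → Representable c k n →
                   Representable (a + c) k (m + n)
Representable-++ {a} {k = k} (xs , xs>0 , Σxs≡m) (ys , ys>0 , Σys≡n) =
  xs ++ ys ,
  (λ i → [_,_] {C = λ s → 0 < [ xs , ys ] s} xs>0 ys>0 (splitAt a i)) ,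
  trans (sumFin-cong (λ i → [,]-∘ (_^ k) (splitAt a i)))
        (trans (sumFin-++ (map (_^ k) xs) (map (_^ k) ys)) (cong₂ _+_ Σxs≡m Σys≡n))

Representable⇒0<length : ∀ {j k n} → 0 < n → Representable j k n → 0 < j
Representable⇒0<length {zero}  0<n (_ , _ , 0≡n) = contradiction (sym 0≡n) (n>0⇒n≢0 0<n)
Representable⇒0<length {suc j} _   _           = z<s

complement-in-window : ∀ {j b d} → 0 < j → j ≤ b → d ≤ b + d ∸ j × b + d ∸ j < b + d
complement-in-window {j} {b} {d} 0<j j≤b =
  subst (d ≤_) (sym (+-∸-comm d j≤b)) (m≤n+m d (b ∸ j)) ,
  ∸-monoʳ-< 0<j (≤-trans j≤b (m≤m+n b d))

theorem2p1 : (k b d N : ℕ) → 0 < k → 0 < b → 0 < d → 0 < N →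
    ((n : ℕ) → N < n → Σ ℕ λ j → j ≤ b × Representable j k n) →
    (nstar : ℕ) → 0 < nstar →
    ((j : ℕ) → d ≤ j → j < b + d → Representable j k nstar) →
    (n : ℕ) → N + nstar < n → Representable (b + d) k n
theorem2p1 k b d N _ _ _ _ fewPowers nstar _ window n N+nstar<n =
  subst (Representable (b + d) k) (m∸n+n≡m nstar≤n) (fill (fewPowers m N<m))
  where
  m : ℕ
  m = n ∸ nstar
  nstar≤n : nstar ≤ n
  nstar≤n = ≤-trans (m≤n+m nstar N) (<⇒≤ N+nstar<n)
  N<m : N < m
  N<m = m+n≤o⇒m≤o∸n (suc N) N+nstar<n
  fill : Σ ℕ (λ j → j ≤ b × Representable j k m) → Representable (b + d) k (m + nstar)
  fill (j , j≤b , rest) =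
    subst (λ a → Representable a k (m + nstar)) (m+[n∸m]≡n (≤-trans j≤b (m≤m+n b d)))
          (Representable-++ {k = k} rest (window (b + d ∸ j) d≤c c<b+d))
    where
    0<j : 0 < j
    0<j = Representable⇒0<length {k = k} (≤-trans z<s N<m) rest
    d≤c : d ≤ b + d ∸ j
    d≤c = proj₁ (complement-in-window 0<j j≤b)
    c<b+d : b + d ∸ j < b + d
    c<b+d = proj₂ (complement-in-window {d = d} 0<j j≤b)
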